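{- Let $d\ge 2$ and let $0\le k<\left\lfloor\frac{d+1}{2}\right\rfloor$. Let $p_1,\dots,p_t$ be the primes $\le k+1$ and let $e_i$ be the integers with $p_i^{e_i}\le k+1<p_i^{e_i+1}$. Then $G(d,k)$ divides \[\frac{d-k+1}{\gcd(d-k+1,\,p_1^{e_1}p_2^{e_2}\cdots p_t^{e_t})}.\]
   Context: Binomial coefficients satisfy $\binom{a}{b}=0$ when $0\le a<b$. Let $\delta=\lfloor d/2\rfloor$ and define, for $0\le i\le\delta$ and $0\le k\le d-1$, $m_{i,k}=\binom{d+1-i}{k+1}-\binom{i}{k+1}$. Define $G(d,k)=\gcd(m_{1,k},m_{2,k},\dots,m_{\delta,k})$. -}

module Defs where

open import Data.Nat using (ℕ; zero; suc; _+_; _*_; _∸_; _^_; _<_; _≤_; NonZero; ≢-nonZero)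
open import Data.Nat.Combinatorics using (_C_)
open import Data.Nat.GCD using (gcd; gcd[m,n]≢0)
open import Data.Nat.DivMod using (_/_)
open import Data.Nat.Primality using (Prime; prime?)
open import Data.Sum using (inj₁)
open import Relation.Nullary using (yes; no)

-- m_{i,k} = C(d+1-i, k+1) - C(i, k+1)   (nonnegative since i ≤ d+1-i for i ≤ ⌊d/2⌋)
m : ℕ → ℕ → ℕ → ℕ
m d i k = ((d + 1) ∸ i) C (k + 1) ∸ (i C (k + 1))

gcdUpTo : (ℕ → ℕ) → ℕ → ℕ
gcdUpTo f zero = 0
gcdUpTo f (suc n) = gcd (gcdUpTo f n) (f (suc n))

G : ℕ → ℕ → ℕ
G d k = gcdUpTo (λ i → m d i k) (d / 2)

primeProd : (ℕ → ℕ) → ℕ → ℕ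
primeProd e zero = 1
primeProd e (suc n) with prime? (suc n)
... | yes _ = primeProd e n * (suc n ^ e (suc n))
... | no  _ = primeProd e n

divByGcd : ℕ → ℕ → ℕ
divByGcd a' b = _/_ (suc a') (gcd (suc a') b)
  {{≢-nonZero (gcd[m,n]≢0 (suc a') b (inj₁ (λ ())))}}

-- G divides m_{i,k} = C(d+1-i, k+1) - C(i, k+1) for every 1 ≤ i ≤ d, because
-- m_{d+1-i,k} = -m_{i,k}.  Hence G divides the iterated differences in i, and the j-th
-- difference is ±C(d+1-i-j, k+1-j) - C(i, k+1-j): at i = s, j = k - s it is ±C(a, s+1)
-- with a = d-k+1, and two differences at i = 1 combine to ±a.  So G divides a and C(a,t)
-- for 1 ≤ t ≤ k+1.  For a prime power p^r ≤ k+1 dividing a, p^r C(a,p^r) = a C(a-1,p^r-1)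
-- with C(a-1,p^r-1) prime to p, whence G p^r ∣ a; the prime powers for different primes
-- combine by coprimality to G gcd(a, ∏ p^{e_p}) ∣ a.
module Submission where

open import Defs
open import Data.Nat
  using (ℕ; zero; suc; _+_; _*_; _∸_; _^_; _<_; _≤_; _≤′_; ≤′-reflexive; ≤′-step; z≤n; s≤s; s≤s⁻¹;
         NonZero; ≢-nonZero; ≢-nonZero⁻¹; nonTrivial⇒≢1)
open import Data.Nat.Properties
open import Data.Nat.Divisibility
open import Data.Nat.DivMod using (_/_; m*n/n≡m; m/n*n≤m; /-monoˡ-≤)
open import Data.Nat.GCD
  using (gcd; gcd[m,n]∣m; gcd[m,n]∣n; gcd-greatest; c*gcd[m,n]≡gcd[cm,cn]; gcd-zeroʳ; gcd[m,n]≢0)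
open import Data.Nat.Coprimality as Coprime using (Coprime; coprime-divisor; coprime-factors)
open import Data.Nat.Primality
  using (Prime; prime?; euclidsLemma; prime⇒nonZero; prime⇒nonTrivial; prime⇒irreducible)
open import Data.Nat.Combinatorics using (_C_; nC1≡n; nCk+nC[k+1]≡[n+1]C[k+1])
open import Data.Nat.Combinatorics.Specification using (k>n⇒nCk≡0)
open import Data.Product using (_×_; _,_; proj₁; ∃-syntax)
open import Data.Sum using (inj₁; inj₂; [_,_]′)
open import Data.Empty using (⊥-elim)
open import Function using (_∘_)
open import Relation.Nullary using (¬_; yes; no)
open import Relation.Binary.Definitions using (tri<; tri≈; tri>)
open import Relation.Binary.PropositionalEquality
open import Data.Integer as ℤ using (ℤ; -_) renaming (+_ to pos)
import Data.Integer.Properties as ℤ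
open import Data.Integer.Divisibility.Signed using (∣ᵤ⇒∣; ∣⇒∣ᵤ; ∣m∣n⇒∣m-n; ∣m⇒∣-m)
  renaming (_∣_ to _∣ℤ_)
open import Data.Integer.Tactic.RingSolver using (solve-∀)

private variable
  a c g k n p r s : ℕ

prime∤1 : Prime p → ¬ p ∣ 1
prime∤1 pp = nonTrivial⇒≢1 {{prime⇒nonTrivial pp}} ∘ ∣1⇒≡1

prime∤⇒coprime : Prime p → ¬ p ∣ n → Coprime p n
prime∤⇒coprime pp p∤n (c∣p , c∣n) with prime⇒irreducible pp c∣p
... | inj₁ c≡1  = c≡1
... | inj₂ refl = ⊥-elim (p∤n c∣n)

∣p^n⇒≡p^r : Prime p → ∀ n → c ∣ p ^ n → ∃[ r ] r ≤ n × c ≡ p ^ r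
∣p^n⇒≡p^r pp zero c∣1 = 0 , z≤n , ∣1⇒≡1 c∣1
∣p^n⇒≡p^r {p} {c} pp (suc n) c∣p^[1+n] with p ∣? c
... | yes (divides q refl) =
  let instance _ = prime⇒nonZero pp
      (r , r≤n , q≡p^r) = ∣p^n⇒≡p^r {c = q} pp n
        (*-cancelʳ-∣ p (subst (q * p ∣_) (*-comm p (p ^ n)) c∣p^[1+n]))
  in suc r , s≤s r≤n , trans (cong (_* p) q≡p^r) (*-comm (p ^ r) p)
... | no p∤c =
  let (r , r≤n , c≡p^r) = ∣p^n⇒≡p^r pp n
        (coprime-divisor (Coprime.sym (prime∤⇒coprime pp p∤c)) c∣p^[1+n])
  in r , m≤n⇒m≤1+n r≤n , c≡p^r

prime∤⇒coprime-^ : Prime p → ¬ p ∣ n → ∀ r → Coprime (p ^ r) n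
prime∤⇒coprime-^ pp p∤n r (c∣p^r , c∣n) with ∣p^n⇒≡p^r pp r c∣p^r
... | zero  , _ , c≡1  = c≡1
... | suc t , _ , refl = ⊥-elim (p∤n (∣-trans (m∣m*n _) c∣n))

prime∣^⇒prime∣ : Prime p → ∀ r → p ∣ n ^ r → p ∣ n
prime∣^⇒prime∣ pp zero p∣1 = ⊥-elim (prime∤1 pp p∣1)
prime∣^⇒prime∣ {n = n} pp (suc r) p∣n^[1+r] with euclidsLemma n (n ^ r) pp p∣n^[1+r]
... | inj₁ p∣n   = p∣n
... | inj₂ p∣n^r = prime∣^⇒prime∣ pp r p∣n^r

gcd[a,m*n]∣gcd[a,m]*gcd[a,n] : ∀ a m n → gcd a (m * n) ∣ gcd a m * gcd a n
gcd[a,m*n]∣gcd[a,m]*gcd[a,n] a m n =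
  subst (gcd a (m * n) ∣_) (sym gcd[a,m]*gcd[a,n]≡gcd[a*h,m*h]) (gcd-greatest ∣a*h ∣m*h)
  where
  h = gcd a n
  gcd[a,m]*gcd[a,n]≡gcd[a*h,m*h] : gcd a m * h ≡ gcd (a * h) (m * h)
  gcd[a,m]*gcd[a,n]≡gcd[a*h,m*h] = trans (*-comm (gcd a m) h)
    (trans (c*gcd[m,n]≡gcd[cm,cn] h a m) (cong₂ gcd (*-comm h a) (*-comm h m)))
  ∣a*h : gcd a (m * n) ∣ a * h
  ∣a*h = ∣-trans (gcd[m,n]∣m a (m * n)) (m∣m*n h)
  ∣m*h : gcd a (m * n) ∣ m * h
  ∣m*h = subst (gcd a (m * n) ∣_) (sym (c*gcd[m,n]≡gcd[cm,cn] m a n))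
    (gcd-greatest (∣-trans (gcd[m,n]∣m a (m * n)) (n∣m*n m)) (gcd[m,n]∣n a (m * n)))

coprime⇒*-∣ : ∀ {m n} → Coprime m n → g * m ∣ a → g * n ∣ a → g * (m * n) ∣ a
coprime⇒*-∣ {g} {a} {m} {n} cop gm∣a gn∣a = coprime-factors cop (gmn∣m*a , gmn∣n*a)
  where
  gmn∣m*a : g * (m * n) ∣ m * a
  gmn∣m*a = subst₂ _∣_ (trans (*-assoc g n m) (cong (g *_) (*-comm n m))) (*-comm a m)
    (*-monoˡ-∣ m gn∣a)
  gmn∣n*a : g * (m * n) ∣ n * a
  gmn∣n*a = subst₂ _∣_ (*-assoc g m n) (*-comm a n) (*-monoˡ-∣ n gm∣a)

∣m∣n⇒∣m∸n : ∀ {m n} → g ∣ m → g ∣ n → g ∣ m ∸ n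
∣m∣n⇒∣m∸n {g} (divides q refl) (divides q′ refl) = divides (q ∸ q′) (sym (*-distribʳ-∸ g q q′))

^-monoʳ-∣ : ∀ p {m n} → m ≤ n → p ^ m ∣ p ^ n
^-monoʳ-∣ p {m} {n} m≤n = divides (p ^ (n ∸ m)) (begin
  p ^ n                 ≡⟨ cong (p ^_) (m+[n∸m]≡n m≤n) ⟨
  p ^ (m + (n ∸ m))     ≡⟨ ^-distribˡ-+-* p m (n ∸ m) ⟩
  p ^ m * p ^ (n ∸ m)   ≡⟨ *-comm (p ^ m) _ ⟩
  p ^ (n ∸ m) * p ^ m   ∎)
  where open ≡-Reasoning

∣p^r∧<⇒p*∣p^r : Prime p → c ∣ p ^ r → c < p ^ r → p * c ∣ p ^ r
∣p^r∧<⇒p*∣p^r {p} {c} {r} pp c∣p^r c<p^r with ∣p^n⇒≡p^r pp r c∣p^r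
... | v , v≤r , refl = ^-monoʳ-∣ p (≤∧≢⇒< v≤r λ { refl → <-irrefl refl c<p^r })

[1+k]*[1+n]C[1+k]≡[1+n]*nCk : ∀ n k → suc k * (suc n C suc k) ≡ suc n * (n C k)
[1+k]*[1+n]C[1+k]≡[1+n]*nCk n zero =
  trans (+-identityʳ _) (trans (nC1≡n (suc n)) (sym (*-identityʳ (suc n))))
[1+k]*[1+n]C[1+k]≡[1+n]*nCk zero (suc k) =
  trans (cong (suc (suc k) *_) (k>n⇒nCk≡0 {1} {2 + k} (s≤s (s≤s z≤n)))) (*-zeroʳ (suc (suc k)))
[1+k]*[1+n]C[1+k]≡[1+n]*nCk (suc n) (suc k) = begin
  suc (suc k) * (suc (suc n) C suc (suc k))
    ≡⟨ cong (suc (suc k) *_) (nCk+nC[k+1]≡[n+1]C[k+1] (suc n) (suc k)) ⟨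
  suc (suc k) * (b + b′)
    ≡⟨ *-distribˡ-+ (suc (suc k)) b b′ ⟩
  b + suc k * b + suc (suc k) * b′
    ≡⟨ cong₂ (λ x y → b + x + y)
         ([1+k]*[1+n]C[1+k]≡[1+n]*nCk n k) ([1+k]*[1+n]C[1+k]≡[1+n]*nCk n (suc k)) ⟩
  b + suc n * (n C k) + suc n * (n C suc k)
    ≡⟨ +-assoc b _ _ ⟩
  b + (suc n * (n C k) + suc n * (n C suc k))
    ≡⟨ cong (b +_) (*-distribˡ-+ (suc n) (n C k) (n C suc k)) ⟨
  b + suc n * (n C k + n C suc k)
    ≡⟨ cong (λ x → b + suc n * x) (nCk+nC[k+1]≡[n+1]C[k+1] n k) ⟩
  suc (suc n) * b ∎
  where
  open ≡-Reasoning
  b = suc n C suc k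
  b′ = suc n C suc (suc k)

[1+k]*nC[1+k]≡[n∸k]*nCk : ∀ n k → suc k * (n C suc k) ≡ (n ∸ k) * (n C k)
[1+k]*nC[1+k]≡[n∸k]*nCk n k = begin
  suc k * (n C suc k)
    ≡⟨ m+n∸m≡n (suc k * (n C k)) _ ⟨
  suc k * (n C k) + suc k * (n C suc k) ∸ suc k * (n C k)
    ≡⟨ cong (_∸ suc k * (n C k)) (*-distribˡ-+ (suc k) (n C k) (n C suc k)) ⟨
  suc k * (n C k + n C suc k) ∸ suc k * (n C k)
    ≡⟨ cong (λ x → suc k * x ∸ suc k * (n C k)) (nCk+nC[k+1]≡[n+1]C[k+1] n k) ⟩
  suc k * (suc n C suc k) ∸ suc k * (n C k)
    ≡⟨ cong (_∸ suc k * (n C k)) ([1+k]*[1+n]C[1+k]≡[1+n]*nCk n k) ⟩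
  suc n * (n C k) ∸ suc k * (n C k)
    ≡⟨ *-distribʳ-∸ (n C k) (suc n) (suc k) ⟨
  (n ∸ k) * (n C k) ∎
  where open ≡-Reasoning

-- (i+1) C(n,i+1) = (n-i) C(n,i), and as p^r ∣ n+1 the factors i+1 and n-i have the same
-- p-part q = gcd(i+1, p^r); cancelling q gives w C(n,i+1) = w′ C(n,i) with p ∤ w′.
prime∤nCi : Prime p → p ^ r ∣ suc n → ∀ i → i < p ^ r → ¬ p ∣ n C i
prime∤nCi pp _ zero _ = prime∤1 pp
prime∤nCi {p} {r} {n} pp p^r∣N (suc i) j<p^r p∣nCj =
  [ p∤w′ , prime∤nCi {r = r} pp p^r∣N i (<⇒≤ j<p^r) ]′
    (euclidsLemma w′ (n C i) pp (subst (p ∣_) w*nCj≡w′*nCi (∣n⇒∣m*n w p∣nCj)))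
  where
  N = suc n
  j = suc i
  q = gcd j (p ^ r)
  instance
    _ : NonZero q
    _ = ≢-nonZero (gcd[m,n]≢0 j (p ^ r) (inj₁ λ ()))
  j≤N : j ≤ N
  j≤N = <⇒≤ (<-≤-trans j<p^r (∣⇒≤ p^r∣N))
  q∣j : q ∣ j
  q∣j = gcd[m,n]∣m j (p ^ r)
  q∣N : q ∣ N
  q∣N = ∣-trans (gcd[m,n]∣n j (p ^ r)) p^r∣N
  q∣N∸j : q ∣ N ∸ j
  q∣N∸j = ∣m∣n⇒∣m∸n q∣N q∣j
  w = quotient q∣j
  w′ = quotient q∣N∸j
  w*nCj≡w′*nCi : w * (n C j) ≡ w′ * (n C i)
  w*nCj≡w′*nCi = *-cancelˡ-≡ _ _ q (begin
    q * (w * (n C j))    ≡⟨ *-assoc q w _ ⟨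
    q * w * (n C j)      ≡⟨ cong (_* (n C j)) (*-comm q w) ⟩
    w * q * (n C j)      ≡⟨ cong (_* (n C j)) (m∣n⇒n≡quotient*m q∣j) ⟨
    j * (n C j)          ≡⟨ [1+k]*nC[1+k]≡[n∸k]*nCk n i ⟩
    (N ∸ j) * (n C i)    ≡⟨ cong (_* (n C i)) (m∣n⇒n≡quotient*m q∣N∸j) ⟩
    w′ * q * (n C i)     ≡⟨ cong (_* (n C i)) (*-comm w′ q) ⟩
    q * w′ * (n C i)     ≡⟨ *-assoc q w′ _ ⟩
    q * (w′ * (n C i))   ∎)
    where open ≡-Reasoning
  p∤w′ : ¬ p ∣ w′
  p∤w′ p∣w′ = prime∤1 pp (*-cancelʳ-∣ q (subst (p * q ∣_) (sym (*-identityˡ q)) pq∣q))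
    where
    pq∣p^r : p * q ∣ p ^ r
    pq∣p^r = ∣p^r∧<⇒p*∣p^r {r = r} pp (gcd[m,n]∣n j (p ^ r)) (≤-<-trans (∣⇒≤ q∣j) j<p^r)
    pq∣N∸j : p * q ∣ N ∸ j
    pq∣N∸j = subst (p * q ∣_) (sym (m∣n⇒n≡quotient*m q∣N∸j)) (*-monoˡ-∣ q p∣w′)
    pq∣j : p * q ∣ j
    pq∣j = subst (p * q ∣_) (m∸[m∸n]≡n j≤N) (∣m∣n⇒∣m∸n (∣-trans pq∣p^r p^r∣N) pq∣N∸j)
    pq∣q : p * q ∣ q
    pq∣q = gcd-greatest pq∣j pq∣p^r

coprime⇒*[1+k]∣ : g ∣ suc n → g ∣ suc n C suc k → Coprime (n C k) (suc k) →
                  g * suc k ∣ suc n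
coprime⇒*[1+k]∣ {g} {n} {k} g∣N g∣NC[1+k] cop = coprime-factors cop (∣nCk*N , ∣[1+k]*N)
  where
  ∣nCk*N : g * suc k ∣ (n C k) * suc n
  ∣nCk*N = subst (g * suc k ∣_)
    (trans (*-comm _ (suc k)) (trans ([1+k]*[1+n]C[1+k]≡[1+n]*nCk n k) (*-comm (suc n) _)))
    (*-monoˡ-∣ (suc k) g∣NC[1+k])
  ∣[1+k]*N : g * suc k ∣ suc k * suc n
  ∣[1+k]*N = subst (g * suc k ∣_) (*-comm (suc n) (suc k)) (*-monoˡ-∣ (suc k) g∣N)

*p^r∣ : Prime p → g ∣ suc n → g ∣ suc n C p ^ r → p ^ r ∣ suc n → g * p ^ r ∣ suc n
*p^r∣ {p} {n = n} {r = r} pp g∣N g∣NC p^r∣N with p ^ r in p^r≡c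
... | zero  = ⊥-elim (≢-nonZero⁻¹ (p ^ r) {{m^n≢0 p r {{prime⇒nonZero pp}}}} p^r≡c)
... | suc k = coprime⇒*[1+k]∣ g∣N g∣NC
  (subst (Coprime (n C k)) p^r≡c (Coprime.sym (prime∤⇒coprime-^ pp p∤nCk r)))
  where
  p∤nCk : ¬ p ∣ n C k
  p∤nCk = prime∤nCi {r = r} pp (subst (_∣ suc n) (sym p^r≡c) p^r∣N) k
            (subst (k <_) (sym p^r≡c) ≤-refl)

*gcd[p^s]∣ : ∀ {K} → Prime p → g ∣ suc n → (∀ t → 0 < t → t ≤ K → g ∣ suc n C t) →
               p ^ s ≤ K → g * gcd (suc n) (p ^ s) ∣ suc n
*gcd[p^s]∣ {p} {g} {n} {s} pp g∣N g∣NC p^s≤K with ∣p^n⇒≡p^r pp s (gcd[m,n]∣n (suc n) (p ^ s))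
... | r , r≤s , gcd≡p^r = subst (λ c → g * c ∣ suc n) (sym gcd≡p^r)
  (*p^r∣ {r = r} pp g∣N (g∣NC (p ^ r) (m^n>0 p r) (≤-trans (^-monoʳ-≤ p r≤s) p^s≤K))
    (subst (_∣ suc n) gcd≡p^r (gcd[m,n]∣m (suc n) (p ^ s))))
  where instance _ = prime⇒nonZero pp

prime∤primeProd : ∀ e n → Prime p → n < p → ¬ p ∣ primeProd e n
prime∤primeProd e zero pp _ = prime∤1 pp
prime∤primeProd {p} e (suc n) pp 1+n<p with prime? (suc n)
... | no _  = prime∤primeProd e n pp (<-trans (n<1+n n) 1+n<p)
... | yes pp′ = [ prime∤primeProd e n pp (<-trans (n<1+n n) 1+n<p) , p∤[1+n]^e ]′
                ∘ euclidsLemma (primeProd e n) (suc n ^ e (suc n)) pp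
  where
  p∤[1+n]^e : ¬ p ∣ suc n ^ e (suc n)
  p∤[1+n]^e p∣ with prime⇒irreducible pp′ (prime∣^⇒prime∣ pp (e (suc n)) p∣)
  ... | inj₁ refl = prime∤1 pp ∣-refl
  ... | inj₂ refl = <-irrefl refl 1+n<p

*gcd[primeProd]∣ : ∀ {K} e → g ∣ suc a → (∀ t → 0 < t → t ≤ K → g ∣ suc a C t) →
                     (∀ p → Prime p → p ≤ K → p ^ e p ≤ K) →
                     ∀ n → n ≤ K → g * gcd (suc a) (primeProd e n) ∣ suc a
*gcd[primeProd]∣ {g} {a} e g∣A _ _ zero _ =
  subst (λ c → g * c ∣ suc a) (sym (gcd-zeroʳ (suc a)))
    (subst (_∣ suc a) (sym (*-identityʳ g)) g∣A)
*gcd[primeProd]∣ {g} {a} e g∣A g∣AC p^e≤K (suc n) 1+n≤K with prime? (suc n)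
... | no _  = *gcd[primeProd]∣ e g∣A g∣AC p^e≤K n (<⇒≤ 1+n≤K)
... | yes pp = ∣-trans (*-monoʳ-∣ g (gcd[a,m*n]∣gcd[a,m]*gcd[a,n] A P Q))
                 (coprime⇒*-∣ {g} coprime-gcds
                   (*gcd[primeProd]∣ e g∣A g∣AC p^e≤K n (<⇒≤ 1+n≤K))
                   (*gcd[p^s]∣ {s = e (suc n)} pp g∣A g∣AC (p^e≤K (suc n) pp 1+n≤K)))
  where
  A = suc a
  P = primeProd e n
  Q = suc n ^ e (suc n)
  coprime-gcds : Coprime (gcd A P) (gcd A Q)
  coprime-gcds (c∣P , c∣Q) = (prime∤⇒coprime-^ pp (prime∤primeProd e n pp ≤-refl) (e (suc n)))
    (∣-trans c∣Q (gcd[m,n]∣n A Q) , ∣-trans c∣P (gcd[m,n]∣n A P))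

Δ^ : ℕ → (ℕ → ℤ) → ℕ → ℤ
Δ^ zero    f i = f i
Δ^ (suc j) f i = Δ^ j f (suc i) ℤ.- Δ^ j f i

∣Δ^ : ∀ {x f lo hi} → (∀ i → lo ≤ i → i ≤ hi → x ∣ℤ f i) →
      ∀ j i → lo ≤ i → i + j ≤ hi → x ∣ℤ Δ^ j f i
∣Δ^ {hi = hi} x∣f zero i lo≤i i≤hi = x∣f i lo≤i (subst (_≤ hi) (+-identityʳ i) i≤hi)
∣Δ^ {hi = hi} x∣f (suc j) i lo≤i i+1+j≤hi = ∣m∣n⇒∣m-n
  (∣Δ^ x∣f j (suc i) (m≤n⇒m≤1+n lo≤i) (subst (_≤ hi) (+-suc i j) i+1+j≤hi))
  (∣Δ^ x∣f j i lo≤i (≤-trans (+-monoʳ-≤ i (n≤1+n j)) i+1+j≤hi))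

neg^ : ℕ → ℤ → ℤ
neg^ zero    x = x
neg^ (suc j) x = - neg^ j x

neg^-distrib-+ : ∀ j x y → neg^ j (x ℤ.+ y) ≡ neg^ j x ℤ.+ neg^ j y
neg^-distrib-+ zero    x y = refl
neg^-distrib-+ (suc j) x y =
  trans (cong -_ (neg^-distrib-+ j x y)) (ℤ.neg-distrib-+ (neg^ j x) (neg^ j y))

∣neg^⇒∣ : ∀ {x y} j → x ∣ℤ neg^ j y → x ∣ℤ y
∣neg^⇒∣ zero    x∣y = x∣y
∣neg^⇒∣ {y = y} (suc j) x∣-y =
  ∣neg^⇒∣ j (subst (_ ∣ℤ_) (ℤ.neg-involutive (neg^ j y)) (∣m⇒∣-m x∣-y))

-- binomDiff (d + 1) (k + 1) i is m_{i,k} computed in ℤ, so it stays meaningful past i = d+1-i.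
binomDiff : ℕ → ℕ → ℕ → ℤ
binomDiff N K i = pos ((N ∸ i) C K) ℤ.- pos (i C K)

pascalℤ : ∀ n k → pos (suc n C suc k) ≡ pos (n C k) ℤ.+ pos (n C suc k)
pascalℤ n k = cong pos (sym (nCk+nC[k+1]≡[n+1]C[k+1] n k))

Δ^-binomDiff : ∀ {N} j K i → i + j ≤ N →
               Δ^ j (binomDiff N (j + K)) i ≡ neg^ j (pos ((N ∸ (i + j)) C K)) ℤ.- pos (i C K)
Δ^-binomDiff zero    K i _ = cong (λ l → pos ((_ ∸ l) C K) ℤ.- pos (i C K)) (sym (+-identityʳ i))
Δ^-binomDiff {N} (suc j) K i i+1+j≤N = begin
  Δ^ (suc j) (binomDiff N (suc j + K)) i
    ≡⟨ cong (λ L → Δ^ (suc j) (binomDiff N L) i) (+-suc j K) ⟨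
  Δ^ j f (suc i) ℤ.- Δ^ j f i
    ≡⟨ cong₂ ℤ._-_ (Δ^-binomDiff j (suc K) (suc i) 1+i+j≤N) Δ^jfi≡ ⟩
  (neg^ j (pos (x C suc K)) ℤ.- pos (suc i C suc K)) ℤ.-
    (neg^ j (pos (suc x C suc K)) ℤ.- pos (i C suc K))
    ≡⟨ cong₂ (λ u v → (neg^ j (pos (x C suc K)) ℤ.- u) ℤ.- (v ℤ.- pos (i C suc K)))
         (pascalℤ i K) (trans (cong (neg^ j) (pascalℤ x K)) (neg^-distrib-+ j _ _)) ⟩
  (neg^ j (pos (x C suc K)) ℤ.- (pos (i C K) ℤ.+ pos (i C suc K))) ℤ.-
    ((neg^ j (pos (x C K)) ℤ.+ neg^ j (pos (x C suc K))) ℤ.- pos (i C suc K))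
    ≡⟨ telescope (neg^ j (pos (x C suc K))) (pos (i C K)) (pos (i C suc K)) (neg^ j (pos (x C K))) ⟩
  - neg^ j (pos (x C K)) ℤ.- pos (i C K)
    ≡⟨ cong (λ l → - neg^ j (pos ((N ∸ l) C K)) ℤ.- pos (i C K)) (+-suc i j) ⟨
  neg^ (suc j) (pos ((N ∸ (i + suc j)) C K)) ℤ.- pos (i C K) ∎
  where
  open ≡-Reasoning
  f = binomDiff N (j + suc K)
  1+i+j≤N : suc (i + j) ≤ N
  1+i+j≤N = subst (_≤ N) (+-suc i j) i+1+j≤N
  x = N ∸ suc (i + j)
  Δ^jfi≡ : Δ^ j f i ≡ neg^ j (pos (suc x C suc K)) ℤ.- pos (i C suc K)
  Δ^jfi≡ = trans (Δ^-binomDiff j (suc K) i (≤-trans (n≤1+n _) 1+i+j≤N))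
    (cong (λ l → neg^ j (pos (l C suc K)) ℤ.- pos (i C suc K)) (+-∸-assoc 1 1+i+j≤N))
  telescope : ∀ s a b t → (s ℤ.- (a ℤ.+ b)) ℤ.- ((t ℤ.+ s) ℤ.- b) ≡ - t ℤ.- a
  telescope = solve-∀

binomDiff-reflect : ∀ {N} K i → i ≤ N → binomDiff N K (N ∸ i) ≡ - binomDiff N K i
binomDiff-reflect {N} K i i≤N = begin
  pos ((N ∸ (N ∸ i)) C K) ℤ.- pos ((N ∸ i) C K)
    ≡⟨ cong (λ l → pos (l C K) ℤ.- pos ((N ∸ i) C K)) (m∸[m∸n]≡n i≤N) ⟩
  pos (i C K) ℤ.- pos ((N ∸ i) C K)             ≡⟨ swap (pos (i C K)) (pos ((N ∸ i) C K)) ⟩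
  - (pos ((N ∸ i) C K) ℤ.- pos (i C K))         ∎
  where
  open ≡-Reasoning
  swap : ∀ a b → a ℤ.- b ≡ - (b ℤ.- a)
  swap = solve-∀

nCk≤[1+n]Ck : ∀ n k → n C k ≤ suc n C k
nCk≤[1+n]Ck n zero    = ≤-refl
nCk≤[1+n]Ck n (suc k) = subst (n C suc k ≤_) (nCk+nC[k+1]≡[n+1]C[k+1] n k) (m≤n+m _ _)

C-monoˡ-≤ : ∀ k {m n} → m ≤ n → m C k ≤ n C k
C-monoˡ-≤ k {m} m≤n = go (≤⇒≤′ m≤n)
  where
  go : ∀ {n} → m ≤′ n → m C k ≤ n C k
  go (≤′-reflexive refl)    = ≤-refl
  go {suc n} (≤′-step m≤′n) = ≤-trans (go m≤′n) (nCk≤[1+n]Ck n k)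

gcdUpTo∣ : ∀ f n i → 1 ≤ i → i ≤ n → gcdUpTo f n ∣ f i
gcdUpTo∣ f zero    (suc i) _ ()
gcdUpTo∣ f (suc n) i 1≤i i≤1+n with i ≟ suc n
... | yes refl = gcd[m,n]∣n (gcdUpTo f n) (f (suc n))
... | no i≢1+n = ∣-trans (gcd[m,n]∣m (gcdUpTo f n) (f (suc n)))
                   (gcdUpTo∣ f n i 1≤i (s≤s⁻¹ (≤∧≢⇒< i≤1+n i≢1+n)))

module _ {d k : ℕ} where

  G∣binomDiff-lower : ∀ {i} → 1 ≤ i → i < (d + 1) ∸ i →
                      pos (G d k) ∣ℤ binomDiff (d + 1) (k + 1) i
  G∣binomDiff-lower {i} 1≤i i<N∸i = subst (pos (G d k) ∣ℤ_) pos[m]≡binomDiff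
    (∣ᵤ⇒∣ (gcdUpTo∣ (λ i → m d i k) (d / 2) i 1≤i i≤d/2))
    where
    i≤N : i ≤ d + 1
    i≤N = <⇒≤ (<-≤-trans i<N∸i (m∸n≤m (d + 1) i))
    i*2≤d : i * 2 ≤ d
    i*2≤d = subst (_≤ d) (trans (cong (i +_) (sym (+-identityʳ i))) (*-comm 2 i))
      (m<1+n⇒m≤n (subst (suc (i + i) ≤_) (+-comm d 1) (m≤o∸n⇒m+n≤o (suc i) i≤N i<N∸i)))
    i≤d/2 : i ≤ d / 2
    i≤d/2 = subst (_≤ d / 2) (m*n/n≡m i 2) (/-monoˡ-≤ 2 i*2≤d)
    pos[m]≡binomDiff : pos (m d i k) ≡ binomDiff (d + 1) (k + 1) i
    pos[m]≡binomDiff = sym (trans (ℤ.[+m]-[+n]≡m⊖n (((d + 1) ∸ i) C (k + 1)) (i C (k + 1)))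
                                  (ℤ.⊖-≥ (C-monoˡ-≤ (k + 1) (<⇒≤ i<N∸i))))

  G∣binomDiff : ∀ i → 1 ≤ i → i ≤ d → pos (G d k) ∣ℤ binomDiff (d + 1) (k + 1) i
  G∣binomDiff i 1≤i i≤d with <-cmp i ((d + 1) ∸ i)
  ... | tri< i<N∸i _ _ = G∣binomDiff-lower 1≤i i<N∸i
  ... | tri≈ _ i≡N∸i _ = subst (pos (G d k) ∣ℤ_) (sym binomDiff≡0) (∣ᵤ⇒∣ {i = pos 0} (G d k ∣0))
    where
    binomDiff≡0 : binomDiff (d + 1) (k + 1) i ≡ pos 0
    binomDiff≡0 = trans (cong (λ l → pos (l C (k + 1)) ℤ.- pos (i C (k + 1))) (sym i≡N∸i))
                        (ℤ.+-inverseʳ (pos (i C (k + 1))))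
  ... | tri> _ _ N∸i<i = subst (pos (G d k) ∣ℤ_) -binomDiff[N∸i]≡binomDiff
    (∣m⇒∣-m (G∣binomDiff-lower 1≤N∸i (subst ((d + 1) ∸ i <_) (sym (m∸[m∸n]≡n i≤N)) N∸i<i)))
    where
    i≤N : i ≤ d + 1
    i≤N = ≤-trans i≤d (m≤m+n d 1)
    1≤N∸i : 1 ≤ (d + 1) ∸ i
    1≤N∸i = m<n⇒0<n∸m (<-≤-trans (s≤s i≤d) (≤-reflexive (+-comm 1 d)))
    -binomDiff[N∸i]≡binomDiff :
      - binomDiff (d + 1) (k + 1) ((d + 1) ∸ i) ≡ binomDiff (d + 1) (k + 1) i
    -binomDiff[N∸i]≡binomDiff = trans (sym (binomDiff-reflect (k + 1) ((d + 1) ∸ i) (m∸n≤m (d + 1) i)))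
                                      (cong (binomDiff (d + 1) (k + 1)) (m∸[m∸n]≡n i≤N))

  private
    [d+1]∸k≡1+[d∸k] : k ≤ d → (d + 1) ∸ k ≡ suc (d ∸ k)
    [d+1]∸k≡1+[d∸k] k≤d = trans (cong (_∸ k) (+-comm d 1)) (+-∸-assoc 1 k≤d)

  G∣[1+d∸k]C[1+s] : ∀ {s} → 1 ≤ s → s ≤ k → k ≤ d → G d k ∣ suc (d ∸ k) C suc s
  G∣[1+d∸k]C[1+s] {s} 1≤s s≤k k≤d =
    ∣⇒∣ᵤ (∣neg^⇒∣ j (subst (pos (G d k) ∣ℤ_) Δ^j≡
      (∣Δ^ G∣binomDiff j s 1≤s (subst (_≤ d) (sym s+j≡k) k≤d))))
    where
    j = k ∸ s
    s+j≡k : s + j ≡ k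
    s+j≡k = m+[n∸m]≡n s≤k
    Δ^j≡ : Δ^ j (binomDiff (d + 1) (k + 1)) s ≡ neg^ j (pos (suc (d ∸ k) C suc s))
    Δ^j≡ = begin
      Δ^ j (binomDiff (d + 1) (k + 1)) s
        ≡⟨ cong (λ L → Δ^ j (binomDiff (d + 1) L) s)
             (trans (+-suc j s) (trans (cong suc (m∸n+n≡m s≤k)) (+-comm 1 k))) ⟨
      Δ^ j (binomDiff (d + 1) (j + suc s)) s
        ≡⟨ Δ^-binomDiff j (suc s) s (≤-trans (≤-reflexive s+j≡k) (≤-trans k≤d (m≤m+n d 1))) ⟩
      neg^ j (pos (((d + 1) ∸ (s + j)) C suc s)) ℤ.- pos (s C suc s)
        ≡⟨ cong₂ (λ l c → neg^ j (pos (l C suc s)) ℤ.- pos c)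
             (trans (cong ((d + 1) ∸_) s+j≡k) ([d+1]∸k≡1+[d∸k] k≤d)) (k>n⇒nCk≡0 (n<1+n s)) ⟩
      neg^ j (pos (suc (d ∸ k) C suc s)) ℤ.- pos 0
        ≡⟨ ℤ.+-identityʳ _ ⟩
      neg^ j (pos (suc (d ∸ k) C suc s)) ∎
      where open ≡-Reasoning

  G∣1+d∸k : k + 2 ≤ d → G d k ∣ suc (d ∸ k)
  G∣1+d∸k k+2≤d = ∣⇒∣ᵤ (∣neg^⇒∣ k (subst (pos (G d k) ∣ℤ_) Δ^k-Δ^[1+k]≡
    (∣m∣n⇒∣m-n (∣Δ^ G∣binomDiff k 1 ≤-refl 1+k≤d) (∣Δ^ G∣binomDiff (suc k) 1 ≤-refl 2+k≤d))))
    where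
    f = binomDiff (d + 1) (k + 1)
    2+k≤d : 1 + suc k ≤ d
    2+k≤d = subst (_≤ d) (+-comm k 2) k+2≤d
    1+k≤d : 1 + k ≤ d
    1+k≤d = <⇒≤ 2+k≤d
    k≤d : k ≤ d
    k≤d = <⇒≤ 1+k≤d
    Δ^k≡ : Δ^ k f 1 ≡ neg^ k (pos (d ∸ k)) ℤ.- pos 1
    Δ^k≡ = trans (Δ^-binomDiff k 1 1 (≤-trans 1+k≤d (m≤m+n d 1)))
      (cong (λ l → neg^ k (pos l) ℤ.- pos 1) (trans (nC1≡n _) (cong (_∸ suc k) (+-comm d 1))))
    Δ^[1+k]≡ : Δ^ (suc k) f 1 ≡ - neg^ k (pos 1) ℤ.- pos 1
    Δ^[1+k]≡ = trans
      (cong (λ L → Δ^ (suc k) (binomDiff (d + 1) L) 1) (trans (+-comm k 1) (sym (+-identityʳ (suc k)))))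
      (Δ^-binomDiff (suc k) 0 1 (≤-trans 2+k≤d (m≤m+n d 1)))
    Δ^k-Δ^[1+k]≡ : Δ^ k f 1 ℤ.- Δ^ (suc k) f 1 ≡ neg^ k (pos (suc (d ∸ k)))
    Δ^k-Δ^[1+k]≡ = begin
      Δ^ k f 1 ℤ.- Δ^ (suc k) f 1
        ≡⟨ cong₂ ℤ._-_ Δ^k≡ Δ^[1+k]≡ ⟩
      (neg^ k (pos (d ∸ k)) ℤ.- pos 1) ℤ.- (- neg^ k (pos 1) ℤ.- pos 1)
        ≡⟨ cancel (neg^ k (pos (d ∸ k))) (neg^ k (pos 1)) ⟩
      neg^ k (pos (d ∸ k)) ℤ.+ neg^ k (pos 1)
        ≡⟨ neg^-distrib-+ k (pos (d ∸ k)) (pos 1) ⟨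
      neg^ k (pos (d ∸ k + 1))
        ≡⟨ cong (neg^ k ∘ pos) (+-comm (d ∸ k) 1) ⟩
      neg^ k (pos (suc (d ∸ k))) ∎
      where
      open ≡-Reasoning
      cancel : ∀ a b → (a ℤ.- pos 1) ℤ.- (- b ℤ.- pos 1) ≡ a ℤ.+ b
      cancel = solve-∀

k<[d+1]/2⇒k+2≤d : ∀ {d} k → 2 ≤ d → k < (d + 1) / 2 → k + 2 ≤ d
k<[d+1]/2⇒k+2≤d zero    2≤d _ = 2≤d
k<[d+1]/2⇒k+2≤d {d} (suc k) _ 1+k<[d+1]/2 = s≤s⁻¹ (begin
  suc (suc k + 2)   ≡⟨ cong suc (+-comm (suc k) 2) ⟩
  4 + k             ≤⟨ +-monoʳ-≤ 4 (m≤m*n k 2) ⟩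
  4 + k * 2         ≡⟨⟩
  suc (suc k) * 2   ≤⟨ *-monoˡ-≤ 2 1+k<[d+1]/2 ⟩
  (d + 1) / 2 * 2   ≤⟨ m/n*n≤m (d + 1) 2 ⟩
  d + 1             ≡⟨ +-comm d 1 ⟩
  suc d             ∎)
  where open ≤-Reasoning

lemma3p4 : (d k : ℕ) → 2 ≤ d → k < (d + 1) / 2 →
    (e : ℕ → ℕ) →
    ((p : ℕ) → Prime p → p ≤ k + 1 → (p ^ e p ≤ k + 1) × (k + 1 < p ^ (e p + 1))) →
    G d k ∣ divByGcd (d ∸ k) (primeProd e (k + 1))
lemma3p4 d k 2≤d k<[d+1]/2 e e-spec =
  m*n∣o⇒m∣o/n (G d k) (gcd (suc (d ∸ k)) (primeProd e (k + 1)))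
    {{≢-nonZero (gcd[m,n]≢0 (suc (d ∸ k)) (primeProd e (k + 1)) (inj₁ λ ()))}}
    (*gcd[primeProd]∣ e G∣A G∣AC (λ p pp p≤k+1 → proj₁ (e-spec p pp p≤k+1)) (k + 1) ≤-refl)
  where
  k+2≤d : k + 2 ≤ d
  k+2≤d = k<[d+1]/2⇒k+2≤d k 2≤d k<[d+1]/2
  G∣A : G d k ∣ suc (d ∸ k)
  G∣A = G∣1+d∸k k+2≤d
  G∣AC : ∀ t → 0 < t → t ≤ k + 1 → G d k ∣ suc (d ∸ k) C t
  G∣AC 1             _ _       = subst (G d k ∣_) (sym (nC1≡n _)) G∣A
  G∣AC (suc (suc s)) _ 2+s≤k+1 =
    G∣[1+d∸k]C[1+s] (s≤s z≤n) (s≤s⁻¹ (subst (2 + s ≤_) (+-comm k 1) 2+s≤k+1))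
      (≤-trans (m≤m+n k 2) k+2≤d)
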